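{- Let $\mu\vdash n$ be an odd partition and $\ell=\ell(\mu)$. Then \[ \mathrm{OKrew}(\mu)=\mathrm{Krew}(\mu)\cdot\binom{n+\ell}{\frac{n+\ell}{2}}\Big/\binom{n}{\frac{n+\ell}{2}}. \]
   Context: For a partition $\mu\vdash n$ with $\ell=\ell(\mu)$ parts, $m_i=m_i(\mu)$ is the number of parts equal to $i$, and $\mu$ is odd if all its parts are odd (so $n+\ell$ is even). The Kreweras number is $\mathrm{Krew}(\mu)=\frac{1}{n-\ell+1}\binom{n}{m_1,\dots,m_n,\,n-\ell}$. For odd $\mu$, the odd Kreweras number is \[ \mathrm{OKrew}(\mu)=\frac{2^{\ell}}{\ell!}\binom{\ell}{m_1,m_3,m_5,\dots}(n+\ell-1)(n+\ell-3)\cdots(n-\ell+3), \] where the product consists of the $\ell-1$ factors $n+\ell-1,n+\ell-3,\dots,n-\ell+3$ (empty product $=1$ when $\ell=1$). -}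

module Defs where

open import Data.Nat as ℕ using (ℕ; zero; suc; _+_; _∸_; _^_; _≥_; _≤_; ⌊_/2⌋)
open import Data.Nat.Combinatorics using (_C_)
open import Data.Nat using (_!)
open import Data.Integer using (+_)
open import Data.Nat.DivMod using (_%_)
open import Data.List using (List; length; map; upTo; filter)
open import Data.Nat.ListAction using (sum; product)
open import Data.List.Relation.Unary.All using (All)
open import Data.List.Relation.Unary.Linked using (Linked)
open import Data.Rational as ℚ using (ℚ; _÷_; _*_; 0ℚ)
open import Data.Rational.Properties using (_≟_)
open import Relation.Nullary.Decidable using (yes; no; does)
open import Relation.Binary.PropositionalEquality using (_≡_)
open import Data.Bool using (if_then_else_)

record IsPartition (n : ℕ) (μ : List ℕ) : Set where
  field
    positive   : All (λ p → p ℕ.≥ 1) μ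
    decreasing : Linked _≥_ μ
    total      : sum μ ≡ n

IsOddPartition : List ℕ → Set
IsOddPartition μ = All (λ p → p % 2 ≡ 1) μ

len : List ℕ → ℕ
len = length

mult : List ℕ → ℕ → ℕ
mult μ i = length (filter (ℕ._≟ i) μ)

⟦_⟧ : ℕ → ℚ
⟦ k ⟧ = (+ k) ℚ./ 1

-- total division on ℚ (x / 0 := 0); only ever applied to nonzero denominators
-- in the theorem (under its hypotheses)
_/'_ : ℚ → ℚ → ℚ
x /' y with y ≟ 0ℚ
... | yes _ = 0ℚ
... | no y≢0 = _÷_ x y {{ℚ.≢-nonZero y≢0}}

infixl 7 _/'_

-- multinomial (n ; m_1,…,m_n, n-ℓ) = n! / (m_1! ⋯ m_n! (n-ℓ)!)
-- parts indices i range over 1..n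
multiplicityFactorials : ℕ → List ℕ → ℕ
multiplicityFactorials n μ = product (map (λ j → (mult μ (suc j)) !) (upTo n))

Krew : ℕ → List ℕ → ℚ
Krew n μ =
  ⟦ n ! ⟧ /' (⟦ n ∸ len μ + 1 ⟧ * ⟦ multiplicityFactorials n μ ⟧ * ⟦ (n ∸ len μ) ! ⟧)

-- product of odd-index multiplicity factorials m_1! m_3! m_5! ⋯ (indices ≤ n)
oddMultiplicityFactorials : ℕ → List ℕ → ℕ
oddMultiplicityFactorials n μ =
  product (map (λ j → (mult μ (suc j)) !) (filter (λ j → j % 2 ℕ.≟ 0) (upTo n)))

descProduct : ℕ → ℕ → ℕ
descProduct n ℓ = product (map (λ j → n + ℓ ∸ 1 ∸ 2 ℕ.* j) (upTo (ℓ ∸ 1)))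

OKrew : ℕ → List ℕ → ℚ
OKrew n μ =
  (⟦ 2 ^ len μ ⟧ /' ⟦ len μ ! ⟧)
  * (⟦ len μ ! ⟧ /' ⟦ oddMultiplicityFactorials n μ ⟧)
  * ⟦ descProduct n (len μ) ⟧

{-# OPTIONS --safe #-}
module Submission where

-- Every part of an odd partition is 1 + 2q, so n = ℓ + 2b and n + ℓ = 2K with K = ℓ + b, and
-- m_i = 0 for even i, so the multinomial denominators of OKrew and Krew agree.  Clearing
-- denominators leaves 2^ℓ (2K−1)(2K−3)⋯(2b+3) (2b+1)! K! = (2K)! b!.  This follows from
-- m! = m‼ (m−1)‼ and (2k)‼ = 2^k k!, applied to m = 2K, 2b+1 and k = K, b, because the
-- product of odd factors is (2K−1)‼ / (2b+1)‼.

open import Defs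
open import Data.Nat as ℕ using (ℕ; zero; suc; _+_; _∸_; _^_; _≤_; _!; ⌊_/2⌋; NonZero; _≟_)
import Data.Nat.Properties as ℕP
open import Data.Nat.Combinatorics using (_C_; nCk≡n!/k![n-k]!; k![n∸k]!∣n!)
open import Data.Nat.DivMod using (_%_; _/_; m/n*n≡m; m≡m%n+[m/n]*n)
open import Data.Nat.ListAction using (sum; product)
open import Data.Nat.ListAction.Properties using (product≢0)
open import Data.Nat.Tactic.RingSolver using (solve-∀)
open import Data.Nat.Coprimality as Coprimality using (1-coprimeTo)
open import Data.Integer using (+_)
import Data.Integer.Properties as ℤP
open import Data.Rational as ℚ using (ℚ; mkℚ; 0ℚ; 1ℚ; 1/_)
import Data.Rational.Properties as ℚP
open import Data.Rational.Solver using (module +-*-Solver)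
open import Data.List using (List; []; _∷_; length; map; filter; upTo; applyUpTo)
open import Data.List.Properties using (map-cong; map-upTo; map-applyUpTo; filter-none)
open import Data.List.Relation.Unary.All as All using ([]; _∷_; universal)
open import Data.List.Relation.Unary.All.Properties using (map⁺)
open import Data.Product using (∃-syntax; _,_)
open import Data.Sum using (_⊎_; inj₁; inj₂)
open import Relation.Nullary using (¬_; yes; no; contradiction)
open import Relation.Unary using (Pred; Decidable)
open import Relation.Binary.PropositionalEquality
  using (_≡_; _≢_; refl; sym; trans; cong; cong₂; subst; module ≡-Reasoning)
open ≡-Reasoning

module DoubleFactorial where
  open import Data.Nat using (_*_)
  open ℕP using (*-assoc; *-comm; *-identityˡ; +-suc; *-suc; ^-distribˡ-+-*)

  infix 8 _‼
  _‼ : ℕ → ℕ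
  zero ‼          = 1
  suc zero ‼      = 1
  suc (suc n) ‼   = suc (suc n) * n ‼

  [1+n]!≡[1+n]‼*n‼ : ∀ n → suc n ! ≡ suc n ‼ * n ‼
  [1+n]!≡[1+n]‼*n‼ zero    = refl
  [1+n]!≡[1+n]‼*n‼ (suc n) = begin
    suc (suc n) * suc n !         ≡⟨ cong (suc (suc n) *_) ([1+n]!≡[1+n]‼*n‼ n) ⟩
    suc (suc n) * (suc n ‼ * n ‼) ≡⟨ regroup (suc (suc n)) (suc n ‼) (n ‼) ⟩
    suc (suc n) * n ‼ * suc n ‼   ∎
    where
    regroup : ∀ x y z → x * (y * z) ≡ x * z * y
    regroup = solve-∀

  [n+n]‼≡2^n*n! : ∀ n → (n + n) ‼ ≡ 2 ^ n * n !
  [n+n]‼≡2^n*n! zero    = refl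
  [n+n]‼≡2^n*n! (suc n) = begin
    (suc n + suc n) ‼              ≡⟨ cong (λ k → suc k ‼) (+-suc n n) ⟩
    (2 + (n + n)) * (n + n) ‼      ≡⟨ cong ((2 + (n + n)) *_) ([n+n]‼≡2^n*n! n) ⟩
    (2 + (n + n)) * (2 ^ n * n !)  ≡⟨ regroup n (2 ^ n) (n !) ⟩
    2 * 2 ^ n * (suc n * n !)      ∎
    where
    regroup : ∀ n x y → (2 + (n + n)) * (x * y) ≡ 2 * x * (suc n * y)
    regroup = solve-∀

  infix 8 _P‼_
  _P‼_ : ℕ → ℕ → ℕ
  c P‼ k = product (map (λ j → c ∸ 2 * j) (upTo k))

  [2+c]P‼[1+k] : ∀ c k → (2 + c) P‼ suc k ≡ (2 + c) * c P‼ k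
  [2+c]P‼[1+k] c k = cong (λ xs → (2 + c) * product xs) (begin
    map f (applyUpTo suc k)                ≡⟨ map-applyUpTo suc f k ⟩
    applyUpTo (λ j → f (suc j)) k          ≡⟨ map-upTo (λ j → f (suc j)) k ⟨
    map (λ j → 2 + c ∸ 2 * suc j) (upTo k) ≡⟨ map-cong (λ j → cong (2 + c ∸_) (*-suc 2 j)) (upTo k) ⟩
    map (λ j → c ∸ 2 * j) (upTo k)         ∎)
    where
    f : ℕ → ℕ
    f j = 2 + c ∸ 2 * j

  [k+k+r]P‼k*r‼≡[k+k+r]‼ : ∀ k r → (k + k + r) P‼ k * r ‼ ≡ (k + k + r) ‼
  [k+k+r]P‼k*r‼≡[k+k+r]‼ zero    r = *-identityˡ (r ‼)
  [k+k+r]P‼k*r‼≡[k+k+r]‼ (suc k) r = begin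
    (suc k + suc k + r) P‼ suc k * r ‼  ≡⟨ cong (λ c → c P‼ suc k * r ‼) top ⟩
    (2 + c) P‼ suc k * r ‼              ≡⟨ cong (_* r ‼) ([2+c]P‼[1+k] c k) ⟩
    (2 + c) * c P‼ k * r ‼              ≡⟨ *-assoc (2 + c) (c P‼ k) (r ‼) ⟩
    (2 + c) * (c P‼ k * r ‼)            ≡⟨ cong ((2 + c) *_) ([k+k+r]P‼k*r‼≡[k+k+r]‼ k r) ⟩
    (2 + c) ‼                           ≡⟨ cong _‼ top ⟨
    (suc k + suc k + r) ‼               ∎
    where
    c = k + k + r
    top : suc k + suc k + r ≡ 2 + c
    top = cong (λ x → suc x + r) (+-suc k k)

  -- descProduct n ℓ unfolds to (n + ℓ ∸ 1) P‼ (ℓ ∸ 1).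
  descProduct*‼ : ∀ m r → descProduct (suc m + r) (suc m) * suc r ‼ ≡ (m + m + suc r) ‼
  descProduct*‼ m r =
    trans (cong (λ c → c P‼ m * suc r ‼) (top m r)) ([k+k+r]P‼k*r‼≡[k+k+r]‼ m (suc r))
    where
    top : ∀ m r → m + r + suc m ≡ m + m + suc r
    top = solve-∀

  2^ℓ*descProduct*[2b+1]!*[ℓ+b]!≡[2ℓ+2b]!*b! : ∀ m b →
    2 ^ suc m * descProduct (suc m + (b + b)) (suc m) * suc (b + b) ! * (suc m + b) !
      ≡ (suc m + b + (suc m + b)) ! * b !
  2^ℓ*descProduct*[2b+1]!*[ℓ+b]!≡[2ℓ+2b]!*b! m b = begin
    2 ^ ℓ * dp * suc (b + b) ! * K !
      ≡⟨ cong (λ x → 2 ^ ℓ * dp * x * K !) ([1+n]!≡[1+n]‼*n‼ (b + b)) ⟩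
    2 ^ ℓ * dp * (suc (b + b) ‼ * (b + b) ‼) * K !
      ≡⟨ regroup₁ (2 ^ ℓ) dp (suc (b + b) ‼) ((b + b) ‼) (K !) ⟩
    2 ^ ℓ * (dp * suc (b + b) ‼) * (b + b) ‼ * K !
      ≡⟨ cong₂ (λ x y → 2 ^ ℓ * x * y * K !) (trans (descProduct*‼ m (b + b)) (cong _‼ (top m b)))
               ([n+n]‼≡2^n*n! b) ⟩
    2 ^ ℓ * o ‼ * (2 ^ b * b !) * K !
      ≡⟨ regroup₂ (2 ^ ℓ) (o ‼) (2 ^ b) (b !) (K !) ⟩
    o ‼ * (2 ^ ℓ * 2 ^ b * K !) * b !
      ≡⟨ cong (λ x → o ‼ * (x * K !) * b !) (^-distribˡ-+-* 2 ℓ b) ⟨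
    o ‼ * (2 ^ K * K !) * b !
      ≡⟨ cong (λ x → o ‼ * x * b !) ([n+n]‼≡2^n*n! K) ⟨
    o ‼ * (K + K) ‼ * b !
      ≡⟨ cong (_* b !) (trans (*-comm (o ‼) ((K + K) ‼)) (sym ([1+n]!≡[1+n]‼*n‼ o))) ⟩
    (K + K) ! * b !
      ∎
    where
    ℓ  = suc m
    K  = ℓ + b
    dp = descProduct (ℓ + (b + b)) ℓ
    o  = m + b + suc (m + b)
    top : ∀ m b → m + m + suc (b + b) ≡ m + b + suc (m + b)
    top = solve-∀
    regroup₁ : ∀ t d x y k → t * d * (x * y) * k ≡ t * (d * x) * y * k
    regroup₁ = solve-∀
    regroup₂ : ∀ t x u v k → t * x * (u * v) * k ≡ x * (t * u * k) * v
    regroup₂ = solve-∀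

module BinomialCoefficients where
  open import Data.Nat using (_*_)
  open ℕP using (_!≢0; m*n≢0; m*n≢0⇒m≢0; *-cancelʳ-≡; +-comm; m≤m+n; m+n∸m≡n; m+n∸n≡m; ≤-trans; ≤-reflexive;
                 +-monoʳ-≤; [m+n]∸[m+o]≡n∸o; ⌊n/2⌋-mono; n≡⌊n+n/2⌋)
  open DoubleFactorial using (2^ℓ*descProduct*[2b+1]!*[ℓ+b]!≡[2ℓ+2b]!*b!)

  nCk*[k!*[n∸k]!]≡n! : ∀ {n k} → k ≤ n → (n C k) * (k ! * (n ∸ k) !) ≡ n !
  nCk*[k!*[n∸k]!]≡n! {n} {k} k≤n = begin
    (n C k) * (k ! * (n ∸ k) !)                   ≡⟨ cong (_* (k ! * (n ∸ k) !)) (nCk≡n!/k![n-k]! k≤n) ⟩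
    (n ! / (k ! * (n ∸ k) !)) * (k ! * (n ∸ k) !) ≡⟨ m/n*n≡m (k![n∸k]!∣n! k≤n) ⟩
    n !                                           ∎
    where instance _ = m*n≢0 (k !) ((n ∸ k) !) {{k !≢0}} {{(n ∸ k) !≢0}}

  nCk≢0 : ∀ {n k} → k ≤ n → NonZero (n C k)
  nCk≢0 {n} {k} k≤n = m*n≢0⇒m≢0 (n C k) {{subst NonZero (sym (nCk*[k!*[n∸k]!]≡n! k≤n)) (n !≢0)}}

  ⌊[n+ℓ]/2⌋≤n : ∀ {n ℓ} → ℓ ≤ n → ⌊ (n + ℓ) /2⌋ ≤ n
  ⌊[n+ℓ]/2⌋≤n {n} ℓ≤n = ≤-trans (⌊n/2⌋-mono (+-monoʳ-≤ n ℓ≤n)) (≤-reflexive (sym (n≡⌊n+n/2⌋ n)))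

  [ℓ+2b]+ℓ≡[ℓ+b]+[ℓ+b] : ∀ ℓ b → ℓ + (b + b) + ℓ ≡ ℓ + b + (ℓ + b)
  [ℓ+2b]+ℓ≡[ℓ+b]+[ℓ+b] = solve-∀

  2^ℓ*descProduct*nCk*[n∸ℓ+1]!≡n!*[n+ℓ]Ck : ∀ ℓ b .{{_ : NonZero ℓ}} →
    let n = ℓ + (b + b)
        k = ⌊ (n + ℓ) /2⌋
    in 2 ^ ℓ * descProduct n ℓ * (n C k) * ((n ∸ ℓ + 1) * (n ∸ ℓ) !) ≡ n ! * ((n + ℓ) C k)
  2^ℓ*descProduct*nCk*[n∸ℓ+1]!≡n!*[n+ℓ]Ck ℓ@(suc m) b
    -- with K = ℓ + b: n ∸ ℓ = 2b, n + ℓ = K + K and k = K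
    rewrite m+n∸m≡n (suc m) (b + b) | +-comm (b + b) 1 | [ℓ+2b]+ℓ≡[ℓ+b]+[ℓ+b] (suc m) b | sym (n≡⌊n+n/2⌋ (suc m + b))
    = *-cancelʳ-≡ _ _ (K ! * b ! * K !) {{K!b!K!≢0}} (begin
      2 ^ ℓ * dp * (n C K) * suc (b + b) ! * (K ! * b ! * K !)
        ≡⟨ regroup₁ (2 ^ ℓ) dp (n C K) (suc (b + b) !) (K !) (b !) ⟩
      2 ^ ℓ * dp * suc (b + b) ! * K ! * ((n C K) * (K ! * b !))
        ≡⟨ cong₂ _*_ (2^ℓ*descProduct*[2b+1]!*[ℓ+b]!≡[2ℓ+2b]!*b! m b) nCK*[K!*b!]≡n! ⟩
      (K + K) ! * b ! * n !
        ≡⟨ cong (λ x → x * b ! * n !) [K+K]CK*[K!*K!]≡[K+K]! ⟨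
      ((K + K) C K) * (K ! * K !) * b ! * n !
        ≡⟨ regroup₂ ((K + K) C K) (K !) (b !) (n !) ⟩
      n ! * ((K + K) C K) * (K ! * b ! * K !)
        ∎)
    where
    n  = ℓ + (b + b)
    K  = ℓ + b
    dp = descProduct n ℓ
    K!b!K!≢0 : NonZero (K ! * b ! * K !)
    K!b!K!≢0 = m*n≢0 _ _ {{m*n≢0 _ _ {{K !≢0}} {{b !≢0}}}} {{K !≢0}}
    nCK*[K!*b!]≡n! : (n C K) * (K ! * b !) ≡ n !
    nCK*[K!*b!]≡n! = subst (λ j → (n C K) * (K ! * j !) ≡ n !)
      (trans ([m+n]∸[m+o]≡n∸o ℓ (b + b) b) (m+n∸n≡m b b)) (nCk*[k!*[n∸k]!]≡n! (+-monoʳ-≤ ℓ (m≤m+n b b)))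
    [K+K]CK*[K!*K!]≡[K+K]! : ((K + K) C K) * (K ! * K !) ≡ (K + K) !
    [K+K]CK*[K!*K!]≡[K+K]! = subst (λ j → ((K + K) C K) * (K ! * j !) ≡ (K + K) !)
      (m+n∸n≡m K K) (nCk*[k!*[n∸k]!]≡n! (m≤m+n K K))
    regroup₁ : ∀ t d c s k j → t * d * c * s * (k * j * k) ≡ t * d * s * k * (c * (k * j))
    regroup₁ = solve-∀
    regroup₂ : ∀ c k j f → c * (k * k) * j * f ≡ f * c * (k * j * k)
    regroup₂ = solve-∀

module OddPartitions where
  open import Data.Nat using (_*_)
  open ℕP using (_!≢0)

  even⊎suc-even : ∀ j → j % 2 ≡ 0 ⊎ suc j % 2 ≡ 0
  even⊎suc-even zero          = inj₁ refl
  even⊎suc-even (suc zero)    = inj₂ refl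
  even⊎suc-even (suc (suc j)) = even⊎suc-even j

  mult≡0-of-even : ∀ {μ i} → IsOddPartition μ → i % 2 ≡ 0 → mult μ i ≡ 0
  mult≡0-of-even {μ} {i} μ-odd i-even = cong length (filter-none (_≟ i) (All.map part≢i μ-odd))
    where
    part≢i : ∀ {p} → p % 2 ≡ 1 → p ≢ i
    part≢i p-odd refl with trans (sym p-odd) i-even
    ... | ()

  product-map-filter : ∀ {a p} {A : Set a} {P : Pred A p} (P? : Decidable P) (f : A → ℕ) xs →
    (∀ x → ¬ P x → f x ≡ 1) → product (map f (filter P? xs)) ≡ product (map f xs)
  product-map-filter P? f []       f≡1 = refl
  product-map-filter P? f (x ∷ xs) f≡1 with P? x
  ... | yes _  = cong (f x *_) (product-map-filter P? f xs f≡1)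
  ... | no ¬px = begin
    product (map f (filter P? xs)) ≡⟨ product-map-filter P? f xs f≡1 ⟩
    product (map f xs)             ≡⟨ ℕP.*-identityˡ _ ⟨
    1 * product (map f xs)         ≡⟨ cong (_* product (map f xs)) (f≡1 x ¬px) ⟨
    f x * product (map f xs)       ∎

  multiplicityFactorials≡odd : ∀ n {μ} → IsOddPartition μ →
    multiplicityFactorials n μ ≡ oddMultiplicityFactorials n μ
  multiplicityFactorials≡odd n {μ} μ-odd =
    sym (product-map-filter (λ j → j % 2 ≟ 0) (λ j → mult μ (suc j) !) (upTo n) odd-index)
    where
    odd-index : ∀ j → ¬ (j % 2 ≡ 0) → mult μ (suc j) ! ≡ 1
    odd-index j j-odd with even⊎suc-even j
    ... | inj₁ j-even   = contradiction j-even j-odd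
    ... | inj₂ 1+j-even = cong _! (mult≡0-of-even μ-odd 1+j-even)

  oddMultiplicityFactorials≢0 : ∀ n μ → NonZero (oddMultiplicityFactorials n μ)
  oddMultiplicityFactorials≢0 n μ =
    product≢0 (map⁺ (universal (λ j → mult μ (suc j) !≢0) (filter (λ j → j % 2 ≟ 0) (upTo n))))

  sum≡len+2b : ∀ {μ} → IsOddPartition μ → ∃[ b ] sum μ ≡ len μ + (b + b)
  sum≡len+2b []                       = 0 , refl
  sum≡len+2b {p ∷ ps} (p-odd ∷ ps-odd) with sum≡len+2b ps-odd
  ... | b , sum≡ = p / 2 + b , (begin
    p + sum ps                            ≡⟨ cong₂ _+_ p≡1+2q sum≡ ⟩
    1 + p / 2 * 2 + (length ps + (b + b)) ≡⟨ regroup (p / 2) (length ps) b ⟩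
    suc (length ps) + (p / 2 + b + (p / 2 + b)) ∎)
    where
    p≡1+2q : p ≡ 1 + p / 2 * 2
    p≡1+2q = trans (m≡m%n+[m/n]*n p 2) (cong (_+ p / 2 * 2) p-odd)
    regroup : ∀ q l b → 1 + q * 2 + (l + (b + b)) ≡ suc l + (q + b + (q + b))
    regroup = solve-∀

open import Data.Rational using (_*_)
open BinomialCoefficients using (nCk≢0; ⌊[n+ℓ]/2⌋≤n; 2^ℓ*descProduct*nCk*[n∸ℓ+1]!≡n!*[n+ℓ]Ck)
open OddPartitions using (multiplicityFactorials≡odd; oddMultiplicityFactorials≢0; sum≡len+2b)

⟦⟧≡mkℚ : ∀ k → ⟦ k ⟧ ≡ mkℚ (+ k) 0 (Coprimality.sym (1-coprimeTo k))
⟦⟧≡mkℚ k = ℚP.normalize-coprime (Coprimality.sym (1-coprimeTo k))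

⟦⟧-homo-* : ∀ a b → ⟦ a ℕ.* b ⟧ ≡ ⟦ a ⟧ * ⟦ b ⟧
⟦⟧-homo-* a b rewrite ⟦⟧≡mkℚ a | ⟦⟧≡mkℚ b = cong (ℚ._/ 1) (ℤP.pos-* a b)

⟦⟧≢0 : ∀ k .{{_ : NonZero k}} → ⟦ k ⟧ ≢ 0ℚ
⟦⟧≢0 (suc k) eq with trans (cong ℚ.↥_ (sym (⟦⟧≡mkℚ (suc k)))) (cong ℚ.↥_ eq)
... | ()

x/'y*y≡x : ∀ x {y} → y ≢ 0ℚ → x /' y * y ≡ x
x/'y*y≡x x {y} y≢0 with y ℚP.≟ 0ℚ
... | yes y≡0 = contradiction y≡0 y≢0
... | no  _   = begin
  x * 1/ y * y   ≡⟨ ℚP.*-assoc x (1/ y) y ⟩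
  x * (1/ y * y) ≡⟨ cong (x *_) (ℚP.*-inverseˡ y) ⟩
  x * 1ℚ         ≡⟨ ℚP.*-identityʳ x ⟩
  x              ∎
  where instance _ = ℚ.≢-nonZero y≢0

x*y/'y≡x : ∀ x {y} → y ≢ 0ℚ → x * y /' y ≡ x
x*y/'y≡x x {y} y≢0 with y ℚP.≟ 0ℚ
... | yes y≡0 = contradiction y≡0 y≢0
... | no  _   = begin
  x * y * 1/ y   ≡⟨ ℚP.*-assoc x y (1/ y) ⟩
  x * (y * 1/ y) ≡⟨ cong (x *_) (ℚP.*-inverseʳ y) ⟩
  x * 1ℚ         ≡⟨ ℚP.*-identityʳ x ⟩
  x              ∎
  where instance _ = ℚ.≢-nonZero y≢0

*-cancelʳ-≡ : ∀ x z {y} → y ≢ 0ℚ → x * y ≡ z * y → x ≡ z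
*-cancelʳ-≡ x z {y} y≢0 xy≡zy = begin
  x          ≡⟨ x*y/'y≡x x y≢0 ⟨
  x * y /' y ≡⟨ cong (_/' y) xy≡zy ⟩
  z * y /' y ≡⟨ x*y/'y≡x z y≢0 ⟩
  z          ∎

*-≢0 : ∀ {x y} → x ≢ 0ℚ → y ≢ 0ℚ → x * y ≢ 0ℚ
*-≢0 {x} {y} x≢0 y≢0 xy≡0 = x≢0 (*-cancelʳ-≡ x 0ℚ y≢0 (trans xy≡0 (sym (ℚP.*-zeroˡ y))))

clearDenominators : ∀ t f m d u p e a b .{{_ : NonZero f}} .{{_ : NonZero m}} .{{_ : NonZero p}}
  .{{_ : NonZero e}} .{{_ : NonZero b}} → t ℕ.* d ℕ.* b ℕ.* (p ℕ.* e) ≡ u ℕ.* a →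
  (⟦ t ⟧ /' ⟦ f ⟧) * (⟦ f ⟧ /' ⟦ m ⟧) * ⟦ d ⟧ ≡ ⟦ u ⟧ /' (⟦ p ⟧ * ⟦ m ⟧ * ⟦ e ⟧) * ⟦ a ⟧ /' ⟦ b ⟧
clearDenominators t f m d u p e a b tdbpe≡ua =
  *-cancelʳ-≡ _ _ (⟦⟧≢0 b) (*-cancelʳ-≡ _ _ q≢0 (trans lhs·bq (sym rhs·bq)))
  where
  open +-*-Solver using (solve; _:*_; _:=_)
  q : ℚ
  q = ⟦ p ⟧ * ⟦ m ⟧ * ⟦ e ⟧
  q≢0 : q ≢ 0ℚ
  q≢0 = *-≢0 (*-≢0 (⟦⟧≢0 p) (⟦⟧≢0 m)) (⟦⟧≢0 e)
  ⟦tdbpe⟧≡⟦ua⟧ : ⟦ t ⟧ * ⟦ d ⟧ * ⟦ b ⟧ * (⟦ p ⟧ * ⟦ e ⟧) ≡ ⟦ u ⟧ * ⟦ a ⟧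
  ⟦tdbpe⟧≡⟦ua⟧ = begin
    ⟦ t ⟧ * ⟦ d ⟧ * ⟦ b ⟧ * (⟦ p ⟧ * ⟦ e ⟧)
      ≡⟨ cong₂ _*_ (trans (⟦⟧-homo-* (t ℕ.* d) b) (cong (_* ⟦ b ⟧) (⟦⟧-homo-* t d))) (⟦⟧-homo-* p e) ⟨
    ⟦ t ℕ.* d ℕ.* b ⟧ * ⟦ p ℕ.* e ⟧            ≡⟨ ⟦⟧-homo-* (t ℕ.* d ℕ.* b) (p ℕ.* e) ⟨
    ⟦ t ℕ.* d ℕ.* b ℕ.* (p ℕ.* e) ⟧            ≡⟨ cong ⟦_⟧ tdbpe≡ua ⟩
    ⟦ u ℕ.* a ⟧                                ≡⟨ ⟦⟧-homo-* u a ⟩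
    ⟦ u ⟧ * ⟦ a ⟧                              ∎
  lhs·bq : (⟦ t ⟧ /' ⟦ f ⟧) * (⟦ f ⟧ /' ⟦ m ⟧) * ⟦ d ⟧ * ⟦ b ⟧ * q ≡ ⟦ u ⟧ * ⟦ a ⟧
  lhs·bq = begin
    (⟦ t ⟧ /' ⟦ f ⟧) * (⟦ f ⟧ /' ⟦ m ⟧) * ⟦ d ⟧ * ⟦ b ⟧ * (⟦ p ⟧ * ⟦ m ⟧ * ⟦ e ⟧)
      ≡⟨ solve 7 (λ x y d b p m e → x :* y :* d :* b :* (p :* m :* e) := x :* (y :* m) :* d :* b :* (p :* e))
               refl (⟦ t ⟧ /' ⟦ f ⟧) (⟦ f ⟧ /' ⟦ m ⟧) ⟦ d ⟧ ⟦ b ⟧ ⟦ p ⟧ ⟦ m ⟧ ⟦ e ⟧ ⟩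
    (⟦ t ⟧ /' ⟦ f ⟧) * ((⟦ f ⟧ /' ⟦ m ⟧) * ⟦ m ⟧) * ⟦ d ⟧ * ⟦ b ⟧ * (⟦ p ⟧ * ⟦ e ⟧)
      ≡⟨ cong (λ x → (⟦ t ⟧ /' ⟦ f ⟧) * x * ⟦ d ⟧ * ⟦ b ⟧ * (⟦ p ⟧ * ⟦ e ⟧)) (x/'y*y≡x ⟦ f ⟧ (⟦⟧≢0 m)) ⟩
    (⟦ t ⟧ /' ⟦ f ⟧) * ⟦ f ⟧ * ⟦ d ⟧ * ⟦ b ⟧ * (⟦ p ⟧ * ⟦ e ⟧)
      ≡⟨ cong (λ x → x * ⟦ d ⟧ * ⟦ b ⟧ * (⟦ p ⟧ * ⟦ e ⟧)) (x/'y*y≡x ⟦ t ⟧ (⟦⟧≢0 f)) ⟩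
    ⟦ t ⟧ * ⟦ d ⟧ * ⟦ b ⟧ * (⟦ p ⟧ * ⟦ e ⟧)
      ≡⟨ ⟦tdbpe⟧≡⟦ua⟧ ⟩
    ⟦ u ⟧ * ⟦ a ⟧
      ∎
  rhs·bq : ⟦ u ⟧ /' q * ⟦ a ⟧ /' ⟦ b ⟧ * ⟦ b ⟧ * q ≡ ⟦ u ⟧ * ⟦ a ⟧
  rhs·bq = begin
    ⟦ u ⟧ /' q * ⟦ a ⟧ /' ⟦ b ⟧ * ⟦ b ⟧ * q ≡⟨ cong (_* q) (x/'y*y≡x (⟦ u ⟧ /' q * ⟦ a ⟧) (⟦⟧≢0 b)) ⟩
    ⟦ u ⟧ /' q * ⟦ a ⟧ * q                 ≡⟨ solve 3 (λ x a q → x :* a :* q := x :* q :* a) refl (⟦ u ⟧ /' q) ⟦ a ⟧ q ⟩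
    ⟦ u ⟧ /' q * q * ⟦ a ⟧                 ≡⟨ cong (_* ⟦ a ⟧) (x/'y*y≡x ⟦ u ⟧ q≢0) ⟩
    ⟦ u ⟧ * ⟦ a ⟧                          ∎

okrew≡krew-ratio : ∀ {n μ} b .{{_ : NonZero (len μ)}} → n ≡ len μ + (b + b) → IsOddPartition μ →
  OKrew n μ ≡ Krew n μ * ⟦ (n + len μ) C ⌊ (n + len μ) /2⌋ ⟧ /' ⟦ n C ⌊ (n + len μ) /2⌋ ⟧
okrew≡krew-ratio {n} {μ} b refl μ-odd = begin
  OKrew n μ
    ≡⟨ clearDenominators (2 ^ ℓ) (ℓ !) M (descProduct n ℓ) (n !) (n ∸ ℓ + 1) ((n ∸ ℓ) !) ((n + ℓ) C k) (n C k)
         {{ℓ !≢0}} {{oddMultiplicityFactorials≢0 n μ}} {{ℕ.≢-nonZero (ℕP.m+1+n≢0 (n ∸ ℓ))}} {{(n ∸ ℓ) !≢0}}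
         {{nCk≢0 (⌊[n+ℓ]/2⌋≤n (ℕP.m≤m+n ℓ (b + b)))}}
         (2^ℓ*descProduct*nCk*[n∸ℓ+1]!≡n!*[n+ℓ]Ck ℓ b) ⟩
  ⟦ n ! ⟧ /' (⟦ n ∸ ℓ + 1 ⟧ * ⟦ M ⟧ * ⟦ (n ∸ ℓ) ! ⟧) * ⟦ (n + ℓ) C k ⟧ /' ⟦ n C k ⟧
    ≡⟨ cong (λ x → ⟦ n ! ⟧ /' (⟦ n ∸ ℓ + 1 ⟧ * ⟦ x ⟧ * ⟦ (n ∸ ℓ) ! ⟧) * ⟦ (n + ℓ) C k ⟧ /' ⟦ n C k ⟧)
            (multiplicityFactorials≡odd n μ-odd) ⟨
  Krew n μ * ⟦ (n + ℓ) C k ⟧ /' ⟦ n C k ⟧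
    ∎
  where
  open ℕP using (_!≢0)
  ℓ = len μ
  k = ⌊ (n + ℓ) /2⌋
  M = oddMultiplicityFactorials n μ

proposition4p2 : (n : ℕ) (μ : List ℕ) → IsPartition n μ → IsOddPartition μ →
    OKrew n μ ≡ Krew n μ * ⟦ (n + len μ) C ⌊ (n + len μ) /2⌋ ⟧ /' ⟦ n C ⌊ (n + len μ) /2⌋ ⟧
proposition4p2 n []      μ⊢n _     rewrite sym (IsPartition.total μ⊢n) = refl
proposition4p2 n (_ ∷ _) μ⊢n μ-odd =
  let b , sum≡ℓ+2b = sum≡len+2b μ-odd
  in okrew≡krew-ratio b (trans (sym (IsPartition.total μ⊢n)) sum≡ℓ+2b) μ-odd
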